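{- Let $k$ be a positive integer. Consider $2k$ balls, colored with $k$ colors so that each color appears on exactly two balls, and let $B$ be a set of $k$ balls sampled uniformly at random without replacement from these $2k$ balls. For an integer $i$, let $E_i$ be the event that $B$ contains balls of exactly $i$ distinct colors. Then for every $i \geq 7k/8$, \[ \Pr[E_i] \leq \frac{5}{\sqrt{k}} \cdot 2^{ -k/16}. \] -}

module Defs where

open import Data.Nat using (ℕ; zero; suc; _+_; _≟_)
open import Data.Bool using (Bool; true; false; _∨_; if_then_else_)
open import Data.Product using (_×_; _,_)
open import Data.List using (List; []; _∷_; concatMap; map; filter; length)
open import Data.Vec using (Vec; []; _∷_)
open import Relation.Nullary.Decidable using (_×-dec_)

-- The 2k balls are modelled as pairs (c , b) with c a colour in {0..k-1}
-- and b ∈ Bool distinguishing the two balls of colour c.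
-- A subset of the balls is thus a vector, indexed by colour, recording
-- for each colour which of its two balls are included.
Selection : ℕ → Set
Selection k = Vec (Bool × Bool) k

allSel : (k : ℕ) → List (Selection k)
allSel zero = [] ∷ []
allSel (suc k) =
  concatMap (λ p → map (p ∷_) (allSel k))
    ((false , false) ∷ (false , true) ∷ (true , false) ∷ (true , true) ∷ [])

bit : Bool → ℕ
bit b = if b then 1 else 0

size : ∀ {k} → Selection k → ℕ
size [] = 0
size ((a , b) ∷ s) = bit a + bit b + size s

colours : ∀ {k} → Selection k → ℕ
colours [] = 0
colours ((a , b) ∷ s) = bit (a ∨ b) + colours s

-- number of k-element subsets of the 2k balls
-- (= size of the uniform sample space, i.e. (2k choose k))
total : ℕ → ℕ
total k = length (filter (λ s → size s ≟ k) (allSel k))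

-- number of k-element subsets containing balls of exactly i distinct colours
-- (so Pr[E_i] = countE k i / total k)
countE : ℕ → ℕ → ℕ
countE k i = length (filter (λ s → (size s ≟ k) ×-dec (colours s ≟ i)) (allSel k))

-- Its profile (s , d) counts
-- the colours with exactly one, resp. both, balls chosen, so |B| = s + 2d
-- and B has s + d colours.  Splitting off the first colour gives recursions
-- for the number of subsets of a given size and of a given profile, whence
-- the closed forms C(2k,m) (ofSize-row, by Pascal's rule) and the multinomial
-- count k! 2^b / (a! b! c!) (ofProfile-formula).
-- For k ≥ 29 three estimates are combined (large-estimate):
--   weighting subsets by 3^s:    |E_i| 9^i ≤ 3^k 8^k        (countE-weighted),
--   central binomial bound:      C(2k,k)² (4k+1) ≥ 16^k     (total-lower),
--   exponential beats polynomial: 2^(17k) (k(4k+1))^8 ≤ 5^16 3^(12k) (growth).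
-- For k ≤ 28 the closed forms turn the claim into finitely many exact
-- integer inequalities, verified by evaluation (small-exact).
module Submission where

open import Defs
open import Data.Nat using (ℕ; zero; suc; _+_; _*_; _^_; _≤_; _<_; _∸_; _≡ᵇ_; _≟_; _!; z≤n; s≤s; NonZero; >-nonZero)
open import Data.Nat.Properties
open import Data.Bool using (Bool; true; false; _∧_; _∨_; _xor_; T)
open import Data.Bool.Properties using (T-∧; ⇔→≡; T-≡; ∧-zeroʳ)
open import Data.Product using (_×_; _,_)
open import Data.Unit using (tt)
open import Data.List using (List; []; _∷_; _++_; map; filter; length; concatMap)
open import Data.List.Properties using (map-++; map-cong; map-∘)
open import Data.Nat.ListAction using (sum)
open import Data.Nat.ListAction.Properties using (sum-++)
open import Data.Vec using ([]; _∷_)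
open import Function using (_∘_; Equivalence; mk⇔)
open import Relation.Nullary using (¬_; Dec; yes; no; does; _×-dec_; _→-dec_)
open import Relation.Nullary.Decidable using (toWitness)
open import Data.Empty using (⊥-elim)
open import Relation.Binary.PropositionalEquality
open import Data.Nat.Tactic.RingSolver using (solve-∀)

Σ : {A : Set} → (A → ℕ) → List A → ℕ
Σ f xs = sum (map f xs)

Σ-cong : {A : Set} {f g : A → ℕ} (xs : List A) → (∀ x → f x ≡ g x) → Σ f xs ≡ Σ g xs
Σ-cong xs f≗g = cong sum (map-cong f≗g xs)

Σ-mono : {A : Set} {f g : A → ℕ} (xs : List A) → (∀ x → f x ≤ g x) → Σ f xs ≤ Σ g xs
Σ-mono [] f≤g = z≤n
Σ-mono (x ∷ xs) f≤g = +-mono-≤ (f≤g x) (Σ-mono xs f≤g)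

Σ-zero : {A : Set} {f : A → ℕ} (xs : List A) → (∀ x → f x ≡ 0) → Σ f xs ≡ 0
Σ-zero [] f≡0 = refl
Σ-zero (x ∷ xs) f≡0 = cong₂ _+_ (f≡0 x) (Σ-zero xs f≡0)

Σ-*ˡ : {A : Set} (c : ℕ) (f : A → ℕ) (xs : List A) → Σ (λ x → c * f x) xs ≡ c * Σ f xs
Σ-*ˡ c f [] = sym (*-zeroʳ c)
Σ-*ˡ c f (x ∷ xs) = trans (cong (c * f x +_) (Σ-*ˡ c f xs)) (sym (*-distribˡ-+ c (f x) (Σ f xs)))

Σ-concatMap : {A B : Set} (f : B → ℕ) (g : A → List B) (xs : List A) →
  Σ f (concatMap g xs) ≡ Σ (λ x → Σ f (g x)) xs
Σ-concatMap f g [] = refl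
Σ-concatMap f g (x ∷ xs) = begin
    sum (map f (g x ++ concatMap g xs))
  ≡⟨ cong sum (map-++ f (g x) (concatMap g xs)) ⟩
    sum (map f (g x) ++ map f (concatMap g xs))
  ≡⟨ sum-++ (map f (g x)) (map f (concatMap g xs)) ⟩
    Σ f (g x) + Σ f (concatMap g xs)
  ≡⟨ cong (Σ f (g x) +_) (Σ-concatMap f g xs) ⟩
    Σ f (g x) + Σ (λ x → Σ f (g x)) xs ∎
  where open ≡-Reasoning

Σ-map : {A B : Set} (f : B → ℕ) (g : A → B) (xs : List A) → Σ f (map g xs) ≡ Σ (f ∘ g) xs
Σ-map f g xs = cong sum (sym (map-∘ xs))

^-distribʳ-* : ∀ m n o → (m * n) ^ o ≡ m ^ o * n ^ o
^-distribʳ-* m n zero = refl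
^-distribʳ-* m n (suc o) = trans (cong (m * n *_) (^-distribʳ-* m n o)) (interchange m n (m ^ o) (n ^ o))
  where
  interchange : ∀ a b c d → a * b * (c * d) ≡ a * c * (b * d)
  interchange = solve-∀

*-exchange : ∀ p q r → p * (q * r) ≡ q * (p * r)
*-exchange = solve-∀

count : (k : ℕ) → (Selection k → Bool) → ℕ
count k P = Σ (bit ∘ P) (allSel k)

length-filter-count : {A : Set} {P : A → Set} (P? : ∀ x → Dec (P x)) (xs : List A) →
  length (filter P? xs) ≡ Σ (bit ∘ does ∘ P?) xs
length-filter-count P? [] = refl
length-filter-count P? (x ∷ xs) with does (P? x)
... | true = cong suc (length-filter-count P? xs)
... | false = length-filter-count P? xs

count-cong : ∀ k {P Q : Selection k → Bool} → (∀ x → P x ≡ Q x) → count k P ≡ count k Q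
count-cong k P≗Q = Σ-cong (allSel k) (cong bit ∘ P≗Q)

count-none : ∀ k {P : Selection k → Bool} → (∀ x → ¬ T (P x)) → count k P ≡ 0
count-none k {P} never = Σ-zero (allSel k) (λ x → bit-false (never x))
  where
  bit-false : ∀ {b} → ¬ T b → bit b ≡ 0
  bit-false {false} _ = refl
  bit-false {true} ¬t = ⊥-elim (¬t _)

count-empty : ∀ k → count k (λ _ → false) ≡ 0
count-empty k = count-none k (λ _ ())

FF FT TF TT : Bool × Bool
FF = false , false
FT = false , true
TF = true , false
TT = true , true

Σ-allSel-suc : ∀ k (f : Selection (suc k) → ℕ) →
  Σ f (allSel (suc k)) ≡
    Σ (f ∘ (FF ∷_)) (allSel k) + (Σ (f ∘ (FT ∷_)) (allSel k)
      + (Σ (f ∘ (TF ∷_)) (allSel k) + (Σ (f ∘ (TT ∷_)) (allSel k) + 0)))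
Σ-allSel-suc k f = trans (Σ-concatMap f (λ p → map (p ∷_) (allSel k)) (FF ∷ FT ∷ TF ∷ TT ∷ []))
  (cong₂ _+_ (Σ-map f (FF ∷_) (allSel k)) (cong₂ _+_ (Σ-map f (FT ∷_) (allSel k))
  (cong₂ _+_ (Σ-map f (TF ∷_) (allSel k)) (cong₂ _+_ (Σ-map f (TT ∷_) (allSel k)) refl))))

count-suc : ∀ k (P : Selection (suc k) → Bool) →
  count (suc k) P ≡
    count k (P ∘ (FF ∷_)) + (count k (P ∘ (FT ∷_)) + (count k (P ∘ (TF ∷_)) + (count k (P ∘ (TT ∷_)) + 0)))
count-suc k P = Σ-allSel-suc k (bit ∘ P)

bit≤1 : ∀ b → bit b ≤ 1
bit≤1 false = z≤n
bit≤1 true = s≤s z≤n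

single double : Bool × Bool → ℕ
single (a , b) = bit (a xor b)
double (a , b) = bit (a ∧ b)

nSingle nDouble : ∀ {k} → Selection k → ℕ
nSingle [] = 0
nSingle (p ∷ s) = single p + nSingle s
nDouble [] = 0
nDouble (p ∷ s) = double p + nDouble s

size-profile : ∀ {k} (x : Selection k) → size x ≡ nSingle x + 2 * nDouble x
size-profile [] = refl
size-profile ((a , b) ∷ s) = begin
    bit a + bit b + size s
  ≡⟨ cong₂ _+_ (pair a b) (size-profile s) ⟩
    (single (a , b) + 2 * double (a , b)) + (nSingle s + 2 * nDouble s)
  ≡⟨ regroup (single (a , b)) (double (a , b)) (nSingle s) (nDouble s) ⟩
    nSingle ((a , b) ∷ s) + 2 * nDouble ((a , b) ∷ s) ∎
  where
  open ≡-Reasoning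
  pair : ∀ a b → bit a + bit b ≡ single (a , b) + 2 * double (a , b)
  pair false false = refl
  pair false true = refl
  pair true false = refl
  pair true true = refl
  regroup : ∀ s d s′ d′ → (s + 2 * d) + (s′ + 2 * d′) ≡ (s + s′) + 2 * (d + d′)
  regroup = solve-∀

colours-profile : ∀ {k} (x : Selection k) → colours x ≡ nSingle x + nDouble x
colours-profile [] = refl
colours-profile ((a , b) ∷ s) =
  trans (cong₂ _+_ (pair a b) (colours-profile s))
        (regroup (single (a , b)) (double (a , b)) (nSingle s) (nDouble s))
  where
  pair : ∀ a b → bit (a ∨ b) ≡ single (a , b) + double (a , b)
  pair false false = refl
  pair false true = refl
  pair true false = refl
  pair true true = refl
  regroup : ∀ s d s′ d′ → (s + d) + (s′ + d′) ≡ (s + s′) + (d + d′)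
  regroup = solve-∀

colours-≤ : ∀ {k} (x : Selection k) → colours x ≤ k
colours-≤ [] = z≤n
colours-≤ ((a , b) ∷ s) = +-mono-≤ (bit≤1 (a ∨ b)) (colours-≤ s)

shift : (ℕ → ℕ) → ℕ → ℕ
shift f zero = 0
shift f (suc m) = f m

pascalStep : (ℕ → ℕ) → ℕ → ℕ
pascalStep f m = f m + shift f m

-- f is the N-th row of Pascal's triangle: f m = N! / (m! (N-m)!) for
-- m ≤ N (stated without division) and f m = 0 beyond N.
record BinomialRow (N : ℕ) (f : ℕ → ℕ) : Set where
  field
    closed : ∀ m r → m + r ≡ N → f m * (m ! * r !) ≡ N !
    beyond : ∀ m → N < m → f m ≡ 0

binomialRow-cong : ∀ {N f g} → (∀ m → f m ≡ g m) → BinomialRow N f → BinomialRow N g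
binomialRow-cong {N} f≗g row = record
  { closed = λ m r e → trans (cong (_* (m ! * r !)) (sym (f≗g m))) (closed m r e)
  ; beyond = λ m N<m → trans (sym (f≗g m)) (beyond m N<m)
  }
  where open BinomialRow row

pascal : ∀ {N f} → BinomialRow N f → BinomialRow (suc N) (pascalStep f)
pascal {N} {f} row = record { closed = closed′ ; beyond = beyond′ }
  where
  open BinomialRow row
  open ≡-Reasoning
  peelʳ : ∀ x y n z → x * (y * (suc n * z)) ≡ suc n * (x * (y * z))
  peelʳ = solve-∀
  peelˡ : ∀ x n y z → x * ((suc n * y) * z) ≡ suc n * (x * (y * z))
  peelˡ = solve-∀
  unshifted : ∀ m r → m + r ≡ suc N → f m * (m ! * r !) ≡ r * N !
  unshifted m zero e = cong (_* (m ! * 1)) (beyond m (≤-reflexive (sym (trans (sym (+-identityʳ m)) e))))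
  unshifted m (suc r) e = begin
      f m * (m ! * (suc r * r !))
    ≡⟨ peelʳ (f m) (m !) r (r !) ⟩
      suc r * (f m * (m ! * r !))
    ≡⟨ cong (suc r *_) (closed m r (suc-injective (trans (sym (+-suc m r)) e))) ⟩
      suc r * N ! ∎
  shifted : ∀ m r → m + r ≡ suc N → shift f m * (m ! * r !) ≡ m * N !
  shifted zero r e = refl
  shifted (suc m) r e = begin
      f m * ((suc m * m !) * r !)
    ≡⟨ peelˡ (f m) m (m !) (r !) ⟩
      suc m * (f m * (m ! * r !))
    ≡⟨ cong (suc m *_) (closed m r (suc-injective e)) ⟩
      suc m * N ! ∎
  closed′ : ∀ m r → m + r ≡ suc N → pascalStep f m * (m ! * r !) ≡ suc N !
  closed′ m r e = begin
      (f m + shift f m) * (m ! * r !)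
    ≡⟨ *-distribʳ-+ (m ! * r !) (f m) (shift f m) ⟩
      f m * (m ! * r !) + shift f m * (m ! * r !)
    ≡⟨ cong₂ _+_ (unshifted m r e) (shifted m r e) ⟩
      r * N ! + m * N !
    ≡⟨ sym (*-distribʳ-+ (N !) r m) ⟩
      (r + m) * N !
    ≡⟨ cong (_* N !) (trans (+-comm r m) e) ⟩
      suc N * N ! ∎
  beyond′ : ∀ m → suc N < m → pascalStep f m ≡ 0
  beyond′ (suc m) (s≤s N<m) = cong₂ _+_ (beyond (suc m) (m<n⇒m<1+n N<m)) (beyond m N<m)

ofSize : ℕ → ℕ → ℕ
ofSize k m = count k (λ x → size x ≡ᵇ m)

-- A new colour contributes 0, 1, 1 or 2 chosen balls: two Pascal steps.
ofSize-suc : ∀ k m → ofSize (suc k) m ≡ pascalStep (pascalStep (ofSize k)) m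
ofSize-suc k zero rewrite count-suc k (λ x → size x ≡ᵇ 0) | count-empty k =
  regroup (ofSize k 0)
  where
  regroup : ∀ a → a + (0 + (0 + (0 + 0))) ≡ a + 0 + 0
  regroup = solve-∀
ofSize-suc k (suc zero) rewrite count-suc k (λ x → size x ≡ᵇ 1) | count-empty k =
  regroup (ofSize k 1) (ofSize k 0)
  where
  regroup : ∀ a b → a + (b + (b + (0 + 0))) ≡ a + b + (b + 0)
  regroup = solve-∀
ofSize-suc k (suc (suc m)) rewrite count-suc k (λ x → size x ≡ᵇ suc (suc m)) =
  regroup (ofSize k (suc (suc m))) (ofSize k (suc m)) (ofSize k m)
  where
  regroup : ∀ a b c → a + (b + (b + (c + 0))) ≡ a + b + (b + c)
  regroup = solve-∀

ofSize-row : ∀ k → BinomialRow (k + k) (ofSize k)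
ofSize-row zero = record { closed = closed₀ ; beyond = beyond₀ }
  where
  closed₀ : ∀ m r → m + r ≡ 0 → ofSize 0 m * (m ! * r !) ≡ 1
  closed₀ zero zero _ = refl
  beyond₀ : ∀ m → 0 < m → ofSize 0 m ≡ 0
  beyond₀ (suc m) _ = refl
ofSize-row (suc k) =
  subst (λ N → BinomialRow N (ofSize (suc k))) (cong suc (sym (+-suc k k)))
    (binomialRow-cong (sym ∘ ofSize-suc k) (pascal (pascal (ofSize-row k))))

total-closed : ∀ k → total k * (k ! * k !) ≡ (k + k) !
total-closed k = begin
    total k * (k ! * k !)
  ≡⟨ cong (_* (k ! * k !)) (length-filter-count (λ x → size x ≟ k) (allSel k)) ⟩
    ofSize k k * (k ! * k !)
  ≡⟨ BinomialRow.closed (ofSize-row k) k k refl ⟩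
    (k + k) ! ∎
  where open ≡-Reasoning

≡ᵇ-both : ∀ {m n p q} → T ((m ≡ᵇ n) ∧ (p ≡ᵇ q)) → m ≡ n × p ≡ q
≡ᵇ-both {m} {n} {p} {q} t with Equivalence.to T-∧ t
... | t₁ , t₂ = ≡ᵇ⇒≡ m n t₁ , ≡ᵇ⇒≡ p q t₂

ofProfile : ℕ → ℕ → ℕ → ℕ
ofProfile k b c = count k (λ x → (nSingle x ≡ᵇ b) ∧ (nDouble x ≡ᵇ c))

-- A new colour is absent, single (in two ways) or double.
ofProfile-suc : ∀ k b c → ofProfile (suc k) b c ≡
  ofProfile k b c + 2 * shift (λ b′ → ofProfile k b′ c) b + shift (ofProfile k b) c
ofProfile-suc k b c =
  trans (count-suc k (λ x → (nSingle x ≡ᵇ b) ∧ (nDouble x ≡ᵇ c)))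
    (trans (cong₂ (λ s d → ofProfile k b c + (s + (s + (d + 0)))) (single-term b) (double-term c))
      (regroup (ofProfile k b c) (shift (λ b′ → ofProfile k b′ c) b) (shift (ofProfile k b) c)))
  where
  single-term : ∀ b → count k (λ x → (suc (nSingle x) ≡ᵇ b) ∧ (nDouble x ≡ᵇ c))
                        ≡ shift (λ b′ → ofProfile k b′ c) b
  single-term zero = count-empty k
  single-term (suc b) = refl
  double-term : ∀ c → count k (λ x → (nSingle x ≡ᵇ b) ∧ (suc (nDouble x) ≡ᵇ c))
                        ≡ shift (ofProfile k b) c
  double-term zero = count-none k (λ x → subst T (∧-zeroʳ (nSingle x ≡ᵇ b)))
  double-term (suc c) = refl
  regroup : ∀ a s d → a + (s + (s + (d + 0))) ≡ a + 2 * s + d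
  regroup = solve-∀

ofProfile-beyond : ∀ k b c → k < b + c → ofProfile k b c ≡ 0
ofProfile-beyond k b c k<b+c = count-none k impossible
  where
  impossible : ∀ x → ¬ T ((nSingle x ≡ᵇ b) ∧ (nDouble x ≡ᵇ c))
  impossible x t with ≡ᵇ-both {nSingle x} t
  ... | s≡b , d≡c =
    <⇒≱ k<b+c (subst (_≤ k) (trans (colours-profile x) (cong₂ _+_ s≡b d≡c)) (colours-≤ x))

-- The multinomial formula ofProfile k b c = k! 2^b / (a! b! c!), where
-- a = k - b - c is the number of absent colours.
ProfileFormula : ℕ → Set
ProfileFormula k = ∀ a b c → a + b + c ≡ k → ofProfile k b c * (a ! * (b ! * c !)) ≡ k ! * 2 ^ b

absent-term : ∀ {k} → ProfileFormula k → ∀ a b c → a + b + c ≡ suc k →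
  ofProfile k b c * (a ! * (b ! * c !)) ≡ a * (k ! * 2 ^ b)
absent-term {k} formula zero b c e
  rewrite ofProfile-beyond k b c (≤-reflexive (sym e)) = refl
absent-term {k} formula (suc a) b c e = begin
    ofProfile k b c * ((suc a * a !) * (b ! * c !))
  ≡⟨ peel (ofProfile k b c) a (a !) (b ! * c !) ⟩
    suc a * (ofProfile k b c * (a ! * (b ! * c !)))
  ≡⟨ cong (suc a *_) (formula a b c (suc-injective e)) ⟩
    suc a * (k ! * 2 ^ b) ∎
  where
  open ≡-Reasoning
  peel : ∀ x n y z → x * ((suc n * y) * z) ≡ suc n * (x * (y * z))
  peel = solve-∀

single-term : ∀ {k} → ProfileFormula k → ∀ a b c → a + b + c ≡ suc k →
  2 * (shift (λ b′ → ofProfile k b′ c) b * (a ! * (b ! * c !))) ≡ b * (k ! * 2 ^ b)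
single-term formula a zero c e = refl
single-term {k} formula a (suc b) c e = begin
    2 * (ofProfile k b c * (a ! * ((suc b * b !) * c !)))
  ≡⟨ peel (ofProfile k b c) (a !) b (b !) (c !) ⟩
    suc b * 2 * (ofProfile k b c * (a ! * (b ! * c !)))
  ≡⟨ cong (suc b * 2 *_) (formula a b c (suc-injective (trans (cong (_+ c) (sym (+-suc a b))) e))) ⟩
    suc b * 2 * (k ! * 2 ^ b)
  ≡⟨ regroup (suc b) (k !) (2 ^ b) ⟩
    suc b * (k ! * (2 * 2 ^ b)) ∎
  where
  open ≡-Reasoning
  peel : ∀ x y n z w → 2 * (x * (y * ((suc n * z) * w))) ≡ suc n * 2 * (x * (y * (z * w)))
  peel = solve-∀
  regroup : ∀ n f p → n * 2 * (f * p) ≡ n * (f * (2 * p))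
  regroup = solve-∀

double-term : ∀ {k} → ProfileFormula k → ∀ a b c → a + b + c ≡ suc k →
  shift (ofProfile k b) c * (a ! * (b ! * c !)) ≡ c * (k ! * 2 ^ b)
double-term formula a b zero e = refl
double-term {k} formula a b (suc c) e = begin
    ofProfile k b c * (a ! * (b ! * (suc c * c !)))
  ≡⟨ peel (ofProfile k b c) (a !) (b !) c (c !) ⟩
    suc c * (ofProfile k b c * (a ! * (b ! * c !)))
  ≡⟨ cong (suc c *_) (formula a b c (suc-injective (trans (sym (+-suc (a + b) c)) e))) ⟩
    suc c * (k ! * 2 ^ b) ∎
  where
  open ≡-Reasoning
  peel : ∀ x y z n w → x * (y * (z * (suc n * w))) ≡ suc n * (x * (y * (z * w)))
  peel = solve-∀

ofProfile-formula : ∀ k → ProfileFormula k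
ofProfile-formula zero zero zero zero refl = refl
ofProfile-formula (suc k) a b c e = begin
    ofProfile (suc k) b c * Q
  ≡⟨ cong (_* Q) (ofProfile-suc k b c) ⟩
    (ofProfile k b c + 2 * shift (λ b′ → ofProfile k b′ c) b + shift (ofProfile k b) c) * Q
  ≡⟨ distrib (ofProfile k b c) (shift (λ b′ → ofProfile k b′ c) b) (shift (ofProfile k b) c) Q ⟩
    ofProfile k b c * Q + 2 * (shift (λ b′ → ofProfile k b′ c) b * Q) + shift (ofProfile k b) c * Q
  ≡⟨ cong₂ _+_ (cong₂ _+_ (absent-term ih a b c e) (single-term ih a b c e)) (double-term ih a b c e) ⟩
    a * F + b * F + c * F
  ≡⟨ distrib′ a b c F ⟩
    (a + b + c) * F
  ≡⟨ cong (_* F) e ⟩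
    suc k * (k ! * 2 ^ b)
  ≡⟨ sym (*-assoc (suc k) (k !) (2 ^ b)) ⟩
    suc k ! * 2 ^ b ∎
  where
  open ≡-Reasoning
  ih = ofProfile-formula k
  Q = a ! * (b ! * c !)
  F = k ! * 2 ^ b
  distrib : ∀ x y z q → (x + 2 * y + z) * q ≡ x * q + 2 * (y * q) + z * q
  distrib = solve-∀
  distrib′ : ∀ a b c f → a * f + b * f + c * f ≡ (a + b + c) * f
  distrib′ = solve-∀

inE : ∀ k → ℕ → Selection k → Bool
inE k i x = (size x ≡ᵇ k) ∧ (colours x ≡ᵇ i)

countE-count : ∀ k i → countE k i ≡ count k (inE k i)
countE-count k i = length-filter-count (λ x → (size x ≟ k) ×-dec (colours x ≟ i)) (allSel k)

countE-beyond : ∀ k i → k < i → countE k i ≡ 0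
countE-beyond k i k<i = trans (countE-count k i) (count-none k impossible)
  where
  impossible : ∀ x → ¬ T (inE k i x)
  impossible x t with ≡ᵇ-both {size x} t
  ... | _ , colours≡i = <⇒≱ k<i (subst (_≤ k) colours≡i (colours-≤ x))

T-ext : ∀ {p q : Bool} → (T p → T q) → (T q → T p) → p ≡ q
T-ext p⇒q q⇒p = ⇔→≡ {z = true}
  (mk⇔ (Equivalence.to T-≡ ∘ p⇒q ∘ Equivalence.from T-≡) (Equivalence.to T-≡ ∘ q⇒p ∘ Equivalence.from T-≡))

profile-unique : ∀ s d b j → s + 2 * d ≡ b + 2 * j → s + d ≡ b + j → s ≡ b × d ≡ j
profile-unique s d b j size≡ colours≡ = s≡b , d≡j
  where
  twice : ∀ s d → s + 2 * d ≡ (s + d) + d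
  twice = solve-∀
  d≡j : d ≡ j
  d≡j = +-cancelˡ-≡ (b + j) d j
    (trans (cong (_+ d) (sym colours≡)) (trans (sym (twice s d)) (trans size≡ (twice b j))))
  s≡b : s ≡ b
  s≡b = +-cancelʳ-≡ d s b (trans colours≡ (cong (b +_) (sym d≡j)))

countE-profile : ∀ k i b j → i ≡ b + j → k ≡ b + 2 * j → countE k i ≡ ofProfile k b j
countE-profile k i b j i≡ k≡ = trans (countE-count k i) (count-cong k (λ x → T-ext (to x) (from x)))
  where
  to : ∀ x → T (inE k i x) → T ((nSingle x ≡ᵇ b) ∧ (nDouble x ≡ᵇ j))
  to x t with ≡ᵇ-both {size x} t
  ... | size≡k , colours≡i with profile-unique (nSingle x) (nDouble x) b j
          (trans (sym (size-profile x)) (trans size≡k k≡))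
          (trans (sym (colours-profile x)) (trans colours≡i i≡))
  ... | s≡b , d≡j = Equivalence.from T-∧ (≡⇒≡ᵇ _ _ s≡b , ≡⇒≡ᵇ _ _ d≡j)
  from : ∀ x → T ((nSingle x ≡ᵇ b) ∧ (nDouble x ≡ᵇ j)) → T (inE k i x)
  from x t with ≡ᵇ-both {nSingle x} t
  ... | s≡b , d≡j = Equivalence.from T-∧
    ( ≡⇒≡ᵇ _ _ (trans (size-profile x) (trans (cong₂ (λ s d → s + 2 * d) s≡b d≡j) (sym k≡)))
    , ≡⇒≡ᵇ _ _ (trans (colours-profile x) (trans (cong₂ _+_ s≡b d≡j) (sym i≡))))

-- Weighting each subset by 3^(number of single colours), every colour
-- contributes 1 + 3 + 3 + 1 = 8.
single-weight : ∀ k → Σ (λ x → 3 ^ nSingle x) (allSel k) ≡ 8 ^ k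
single-weight zero = refl
single-weight (suc k) = begin
    Σ (λ x → 3 ^ nSingle x) (allSel (suc k))
  ≡⟨ Σ-allSel-suc k (λ x → 3 ^ nSingle x) ⟩
    W + (Σ (λ x → 3 * 3 ^ nSingle x) (allSel k) + (Σ (λ x → 3 * 3 ^ nSingle x) (allSel k) + (W + 0)))
  ≡⟨ cong (λ t → W + (t + (t + (W + 0)))) (Σ-*ˡ 3 (λ x → 3 ^ nSingle x) (allSel k)) ⟩
    W + (3 * W + (3 * W + (W + 0)))
  ≡⟨ eight W ⟩
    8 * W
  ≡⟨ cong (8 *_) (single-weight k) ⟩
    8 * 8 ^ k ∎
  where
  open ≡-Reasoning
  W = Σ (λ x → 3 ^ nSingle x) (allSel k)
  eight : ∀ w → w + (3 * w + (3 * w + (w + 0))) ≡ 8 * w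
  eight = solve-∀

-- A k-subset B with i colours has 2i = k + (single colours of B),
-- so 9^i = 3^k · 3^(single colours of B).
nine^colours : ∀ {k} i (x : Selection k) → T (inE k i x) → 9 ^ i ≡ 3 ^ k * 3 ^ nSingle x
nine^colours {k} i x t with ≡ᵇ-both {size x} t
... | size≡k , colours≡i = begin
    9 ^ i
  ≡⟨ ^-*-assoc 3 2 i ⟩
    3 ^ (2 * i)
  ≡⟨ cong (λ n → 3 ^ (2 * n)) (trans (sym colours≡i) (colours-profile x)) ⟩
    3 ^ (2 * (nSingle x + nDouble x))
  ≡⟨ cong (3 ^_) (twice (nSingle x) (nDouble x)) ⟩
    3 ^ ((nSingle x + 2 * nDouble x) + nSingle x)
  ≡⟨ cong (λ n → 3 ^ (n + nSingle x)) (trans (sym (size-profile x)) size≡k) ⟩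
    3 ^ (k + nSingle x)
  ≡⟨ ^-distribˡ-+-* 3 k (nSingle x) ⟩
    3 ^ k * 3 ^ nSingle x ∎
  where
  open ≡-Reasoning
  twice : ∀ s d → 2 * (s + d) ≡ (s + 2 * d) + s
  twice = solve-∀

countE-weighted : ∀ k i → countE k i * 9 ^ i ≤ 3 ^ k * 8 ^ k
countE-weighted k i = begin
    countE k i * 9 ^ i
  ≡⟨ trans (cong (_* 9 ^ i) (countE-count k i)) (*-comm (count k (inE k i)) (9 ^ i)) ⟩
    9 ^ i * count k (inE k i)
  ≡⟨ Σ-*ˡ (9 ^ i) (bit ∘ inE k i) (allSel k) ⟨
    Σ (λ x → 9 ^ i * bit (inE k i x)) (allSel k)
  ≤⟨ Σ-mono (allSel k) (λ x → weighted-term (nine^colours i x)) ⟩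
    Σ (λ x → 3 ^ k * 3 ^ nSingle x) (allSel k)
  ≡⟨ Σ-*ˡ (3 ^ k) (λ x → 3 ^ nSingle x) (allSel k) ⟩
    3 ^ k * Σ (λ x → 3 ^ nSingle x) (allSel k)
  ≡⟨ cong (3 ^ k *_) (single-weight k) ⟩
    3 ^ k * 8 ^ k ∎
  where
  open ≤-Reasoning
  weighted-term : ∀ {p w v} → (T p → w ≡ v) → w * bit p ≤ v
  weighted-term {false} {w} {v} _ = subst (_≤ v) (sym (*-zeroʳ w)) z≤n
  weighted-term {true} {w} w≡v = ≤-reflexive (trans (*-identityʳ w) (w≡v _))

total-step : ∀ k → total (suc k) * suc k ≡ 2 * (2 * k + 1) * total k
total-step k = *-cancelʳ-≡ _ _ (suc k * (k ! * k !)) {{m*n≢0 (suc k) (k ! * k !) {{_}} {{k !* k !≢0}}}} (begin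
    total (suc k) * suc k * (suc k * (k ! * k !))
  ≡⟨ regroup (total (suc k)) k (k !) ⟩
    total (suc k) * (suc k ! * suc k !)
  ≡⟨ total-closed (suc k) ⟩
    (suc k + suc k) !
  ≡⟨ cong (λ n → suc n !) (+-suc k k) ⟩
    suc (suc (k + k)) * (suc (k + k) * (k + k) !)
  ≡⟨ cong (λ n → suc (suc (k + k)) * (suc (k + k) * n)) (sym (total-closed k)) ⟩
    suc (suc (k + k)) * (suc (k + k) * (total k * (k ! * k !)))
  ≡⟨ regroup′ (total k) k (k !) ⟩
    2 * (2 * k + 1) * total k * (suc k * (k ! * k !)) ∎)
  where
  open ≡-Reasoning
  regroup : ∀ t k f → t * suc k * (suc k * (f * f)) ≡ t * ((suc k * f) * (suc k * f))
  regroup = solve-∀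
  regroup′ : ∀ t k f → suc (suc (k + k)) * (suc (k + k) * (t * (f * f)))
                        ≡ 2 * (2 * k + 1) * t * (suc k * (f * f))
  regroup′ = solve-∀

total-lower : ∀ k → 16 ^ k ≤ total k * total k * (4 * k + 1)
total-lower zero = s≤s z≤n
total-lower (suc k) = *-cancelʳ-≤ _ _ (suc k * suc k) (begin
    16 ^ suc k * (suc k * suc k)
  ≡⟨ regroup (16 ^ k) k ⟩
    16 ^ k * (16 * (suc k * suc k))
  ≤⟨ *-monoˡ-≤ _ (total-lower k) ⟩
    u * u * (4 * k + 1) * (16 * (suc k * suc k))
  ≡⟨ *-assoc (u * u) (4 * k + 1) _ ⟩
    u * u * ((4 * k + 1) * (16 * (suc k * suc k)))
  ≤⟨ *-monoʳ-≤ (u * u) (subst ((4 * k + 1) * (16 * (suc k * suc k)) ≤_) (slack k) (m≤m+n _ 4)) ⟩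
    u * u * (4 * (2 * k + 1) * (2 * k + 1) * (4 * suc k + 1))
  ≡⟨ regroup′ u k ⟩
    (2 * (2 * k + 1) * u) * (2 * (2 * k + 1) * u) * (4 * suc k + 1)
  ≡⟨ cong (λ z → z * z * (4 * suc k + 1)) (sym (total-step k)) ⟩
    (v * suc k) * (v * suc k) * (4 * suc k + 1)
  ≡⟨ regroup″ v k ⟩
    v * v * (4 * suc k + 1) * (suc k * suc k) ∎)
  where
  open ≤-Reasoning
  u = total k
  v = total (suc k)
  regroup : ∀ p k → 16 * p * (suc k * suc k) ≡ p * (16 * (suc k * suc k))
  regroup = solve-∀
  slack : ∀ k → (4 * k + 1) * (16 * (suc k * suc k)) + 4 ≡ 4 * (2 * k + 1) * (2 * k + 1) * (4 * suc k + 1)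
  slack = solve-∀
  regroup′ : ∀ u k → u * u * (4 * (2 * k + 1) * (2 * k + 1) * (4 * suc k + 1))
                      ≡ (2 * (2 * k + 1) * u) * (2 * (2 * k + 1) * u) * (4 * suc k + 1)
  regroup′ = solve-∀
  regroup″ : ∀ v k → (v * suc k) * (v * suc k) * (4 * suc k + 1) ≡ v * v * (4 * suc k + 1) * (suc k * suc k)
  regroup″ = solve-∀

-- The polynomial factor k (4k+1) left over in the large-k estimate.
poly : ℕ → ℕ
poly k = k * (4 * k + 1)

poly-ratio : ∀ t → 6 * poly (suc (t + 29)) ≤ 7 * poly (t + 29)
poly-ratio t = subst (6 * poly (suc (t + 29)) ≤_) (sym (slack t)) (m≤m+n _ _)
  where
  slack : ∀ t → 7 * ((t + 29) * (4 * (t + 29) + 1))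
                ≡ 6 * (suc (t + 29) * (4 * suc (t + 29) + 1)) + (1971 + 185 * t + 4 * (t * t))
  slack = solve-∀

-- (7/6)^8 < 3^12 / 2^17, so with the ratio bound the eighth power grows
-- slower than (3^12 / 2^17)^k.
poly-ratio⁸ : ∀ x y → 6 * y ≤ 7 * x → 2 ^ 17 * y ^ 8 ≤ 3 ^ 12 * x ^ 8
poly-ratio⁸ x y 6y≤7x = *-cancelˡ-≤ (6 ^ 8) (begin
    6 ^ 8 * (2 ^ 17 * y ^ 8)
  ≡⟨ *-exchange (6 ^ 8) (2 ^ 17) (y ^ 8) ⟩
    2 ^ 17 * (6 ^ 8 * y ^ 8)
  ≡⟨ cong (2 ^ 17 *_) (^-distribʳ-* 6 y 8) ⟨
    2 ^ 17 * (6 * y) ^ 8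
  ≤⟨ *-monoʳ-≤ (2 ^ 17) (^-monoˡ-≤ 8 6y≤7x) ⟩
    2 ^ 17 * (7 * x) ^ 8
  ≡⟨ trans (cong (2 ^ 17 *_) (^-distribʳ-* 7 x 8)) (sym (*-assoc (2 ^ 17) (7 ^ 8) (x ^ 8))) ⟩
    (2 ^ 17 * 7 ^ 8) * x ^ 8
  ≤⟨ *-monoˡ-≤ (x ^ 8) (≤ᵇ⇒≤ (2 ^ 17 * 7 ^ 8) (6 ^ 8 * 3 ^ 12) tt) ⟩
    (6 ^ 8 * 3 ^ 12) * x ^ 8
  ≡⟨ *-assoc (6 ^ 8) (3 ^ 12) (x ^ 8) ⟩
    6 ^ 8 * (3 ^ 12 * x ^ 8) ∎)
  where open ≤-Reasoning

growth-step : ∀ a b x y → 6 * y ≤ 7 * x → a ^ 17 * x ^ 8 ≤ 5 ^ 16 * b ^ 12 →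
  (2 * a) ^ 17 * y ^ 8 ≤ 5 ^ 16 * (3 * b) ^ 12
growth-step a b x y 6y≤7x previous = begin
    (2 * a) ^ 17 * y ^ 8
  ≡⟨ cong (_* y ^ 8) (^-distribʳ-* 2 a 17) ⟩
    2 ^ 17 * a ^ 17 * y ^ 8
  ≡⟨ trans (*-assoc (2 ^ 17) (a ^ 17) (y ^ 8)) (*-exchange (2 ^ 17) (a ^ 17) (y ^ 8)) ⟩
    a ^ 17 * (2 ^ 17 * y ^ 8)
  ≤⟨ *-monoʳ-≤ (a ^ 17) (poly-ratio⁸ x y 6y≤7x) ⟩
    a ^ 17 * (3 ^ 12 * x ^ 8)
  ≡⟨ *-exchange (a ^ 17) (3 ^ 12) (x ^ 8) ⟩
    3 ^ 12 * (a ^ 17 * x ^ 8)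
  ≤⟨ *-monoʳ-≤ (3 ^ 12) previous ⟩
    3 ^ 12 * (5 ^ 16 * b ^ 12)
  ≡⟨ *-exchange (3 ^ 12) (5 ^ 16) (b ^ 12) ⟩
    5 ^ 16 * (3 ^ 12 * b ^ 12)
  ≡⟨ cong (5 ^ 16 *_) (^-distribʳ-* 3 b 12) ⟨
    5 ^ 16 * (3 * b) ^ 12 ∎
  where open ≤-Reasoning

growth : ∀ k → 29 ≤ k → (2 ^ k) ^ 17 * poly k ^ 8 ≤ 5 ^ 16 * (3 ^ k) ^ 12
growth k 29≤k = subst (λ k → (2 ^ k) ^ 17 * poly k ^ 8 ≤ 5 ^ 16 * (3 ^ k) ^ 12)
                  (m∸n+n≡m 29≤k) (from29 (k ∸ 29))
  where
  from29 : ∀ t → (2 ^ (t + 29)) ^ 17 * poly (t + 29) ^ 8 ≤ 5 ^ 16 * (3 ^ (t + 29)) ^ 12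
  from29 zero = ≤ᵇ⇒≤ _ _ tt
  from29 (suc t) = growth-step (2 ^ (t + 29)) (3 ^ (t + 29)) (poly (t + 29)) (poly (suc (t + 29))) (poly-ratio t) (from29 t)

-- Combining the weighted bound |E_i| 9^i ≤ 24^k with i ≥ 7k/8:
-- |E_i|^8 3^(14k) ≤ (|E_i| 9^i)^8 ≤ 24^(8k), i.e. |E_i|^8 3^(6k) ≤ 2^(24k).
colour-bound : ∀ X k i → X * 9 ^ i ≤ 3 ^ k * 8 ^ k → 7 * k ≤ 8 * i → X ^ 8 * (3 ^ k) ^ 6 ≤ (2 ^ k) ^ 24
colour-bound X k i weighted 7k≤8i = *-cancelʳ-≤ _ _ ((3 ^ k) ^ 8) {{m^n≢0 (3 ^ k) 8 {{m^n≢0 3 k}}}} (begin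
    X ^ 8 * (3 ^ k) ^ 6 * (3 ^ k) ^ 8
  ≡⟨ trans (*-assoc (X ^ 8) _ _) (cong (X ^ 8 *_) (sym (^-distribˡ-+-* (3 ^ k) 6 8))) ⟩
    X ^ 8 * (3 ^ k) ^ 14
  ≤⟨ *-monoʳ-≤ (X ^ 8) three^k≤nine^i ⟩
    X ^ 8 * (9 ^ i) ^ 8
  ≡⟨ ^-distribʳ-* X (9 ^ i) 8 ⟨
    (X * 9 ^ i) ^ 8
  ≤⟨ ^-monoˡ-≤ 8 weighted ⟩
    (3 ^ k * 8 ^ k) ^ 8
  ≡⟨ ^-distribʳ-* (3 ^ k) (8 ^ k) 8 ⟩
    (3 ^ k) ^ 8 * (8 ^ k) ^ 8
  ≡⟨ trans (*-comm ((3 ^ k) ^ 8) _) (cong (_* (3 ^ k) ^ 8) eight^k) ⟩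
    (2 ^ k) ^ 24 * (3 ^ k) ^ 8 ∎)
  where
  open ≤-Reasoning
  exponents : ∀ k i → 7 * k ≤ 8 * i → k * 14 ≤ 2 * (i * 8)
  exponents k i h = subst₂ _≤_ (twice k) (twice′ i) (*-monoʳ-≤ 2 h)
    where
    twice : ∀ k → 2 * (7 * k) ≡ k * 14
    twice = solve-∀
    twice′ : ∀ i → 2 * (8 * i) ≡ 2 * (i * 8)
    twice′ = solve-∀
  three^k≤nine^i : (3 ^ k) ^ 14 ≤ (9 ^ i) ^ 8
  three^k≤nine^i = subst₂ _≤_ (sym (^-*-assoc 3 k 14))
    (trans (sym (^-*-assoc 3 2 (i * 8))) (sym (^-*-assoc 9 i 8)))
    (^-monoʳ-≤ 3 (exponents k i 7k≤8i))
  eight^k : (8 ^ k) ^ 8 ≡ (2 ^ k) ^ 24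
  eight^k = begin-equality
      (8 ^ k) ^ 8     ≡⟨ ^-*-assoc 8 k 8 ⟩
      8 ^ (k * 8)     ≡⟨ ^-*-assoc 2 3 (k * 8) ⟩
      2 ^ (3 * (k * 8)) ≡⟨ cong (2 ^_) (thrice k) ⟩
      2 ^ (k * 24)    ≡⟨ ^-*-assoc 2 k 24 ⟨
      (2 ^ k) ^ 24 ∎
    where
    thrice : ∀ k → 3 * (k * 8) ≡ k * 24
    thrice = solve-∀

-- The large-k estimate in polynomial form, with a = 2^k, b = 3^k,
-- c = 4k + 1 and T = C(2k,k): multiply out by b^12 c^8 and chain the three bounds.
large-estimate : ∀ X T k a b c .{{_ : NonZero b}} .{{_ : NonZero c}} →
  X ^ 8 * b ^ 6 ≤ a ^ 24 → a ^ 4 ≤ T * T * c → a ^ 17 * (k * c) ^ 8 ≤ 5 ^ 16 * b ^ 12 →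
  X ^ 16 * k ^ 8 * a ≤ 5 ^ 16 * T ^ 16
large-estimate X T k a b c colours central growing =
  *-cancelʳ-≤ _ _ (b ^ 12 * c ^ 8) {{m*n≢0 _ _ {{m^n≢0 b 12}} {{m^n≢0 c 8}}}} (begin
    X ^ 16 * k ^ 8 * a * (b ^ 12 * c ^ 8)
  ≡⟨ cong₂ (λ x y → x * k ^ 8 * a * (y * c ^ 8)) (^-distribˡ-+-* X 8 8) (^-distribˡ-+-* b 6 6) ⟩
    (X ^ 8 * X ^ 8) * k ^ 8 * a * (b ^ 6 * b ^ 6 * c ^ 8)
  ≡⟨ regroup (X ^ 8) (b ^ 6) (k ^ 8) (c ^ 8) a ⟩
    (X ^ 8 * b ^ 6) * (X ^ 8 * b ^ 6) * (a * (k ^ 8 * c ^ 8))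
  ≤⟨ *-monoˡ-≤ (a * (k ^ 8 * c ^ 8)) (*-mono-≤ colours colours) ⟩
    a ^ 24 * a ^ 24 * (a * (k ^ 8 * c ^ 8))
  ≡⟨ cong (_* (a * (k ^ 8 * c ^ 8))) (trans (sym (^-distribˡ-+-* a 24 24)) (^-distribˡ-+-* a 32 16)) ⟩
    a ^ 32 * a ^ 16 * (a * (k ^ 8 * c ^ 8))
  ≡⟨ regroup′ (a ^ 32) (a ^ 16) a (k ^ 8 * c ^ 8) ⟩
    a ^ 32 * (a ^ 17 * (k ^ 8 * c ^ 8))
  ≡⟨ cong₂ (λ x y → x * (a ^ 17 * y)) (^-*-assoc a 4 8) (^-distribʳ-* k c 8) ⟨
    (a ^ 4) ^ 8 * (a ^ 17 * (k * c) ^ 8)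
  ≤⟨ *-mono-≤ (^-monoˡ-≤ 8 central) growing ⟩
    (T * T * c) ^ 8 * (5 ^ 16 * b ^ 12)
  ≡⟨ cong (_* (5 ^ 16 * b ^ 12)) (trans (^-distribʳ-* (T * T) c 8)
       (cong (_* c ^ 8) (trans (^-distribʳ-* T T 8) (sym (^-distribˡ-+-* T 8 8))))) ⟩
    T ^ 16 * c ^ 8 * (5 ^ 16 * b ^ 12)
  ≡⟨ regroup″ (T ^ 16) (c ^ 8) (5 ^ 16) (b ^ 12) ⟩
    5 ^ 16 * T ^ 16 * (b ^ 12 * c ^ 8) ∎)
  where
  open ≤-Reasoning
  regroup : ∀ x y κ γ a → x * x * κ * a * (y * y * γ) ≡ (x * y) * (x * y) * (a * (κ * γ))
  regroup = solve-∀
  regroup′ : ∀ p q a z → p * q * (a * z) ≡ p * ((a * q) * z)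
  regroup′ = solve-∀
  regroup″ : ∀ t γ f β → t * γ * (f * β) ≡ f * t * (β * γ)
  regroup″ = solve-∀

large-case : ∀ k i → 29 ≤ k → 7 * k ≤ 8 * i →
  countE k i ^ 16 * k ^ 8 * 2 ^ k ≤ 5 ^ 16 * total k ^ 16
large-case k i 29≤k 7k≤8i =
  large-estimate (countE k i) (total k) k (2 ^ k) (3 ^ k) (4 * k + 1)
    {{m^n≢0 3 k}} {{>-nonZero (m≤n+m 1 (4 * k))}}
    (colour-bound (countE k i) k i (countE-weighted k i) 7k≤8i)
    (subst (_≤ total k * total k * (4 * k + 1)) sixteen^k (total-lower k))
    (growth k 29≤k)
  where
  sixteen^k : 16 ^ k ≡ (2 ^ k) ^ 4
  sixteen^k = trans (^-*-assoc 2 4 k) (trans (cong (2 ^_) (*-comm 4 k)) (sym (^-*-assoc 2 k 4)))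

half-of : ∀ {k i} → 7 * k ≤ 8 * i → k ≤ 2 * i
half-of {k} {i} 7k≤8i =
  *-cancelˡ-≤ 4 (≤-trans (*-monoˡ-≤ k (m≤m+n 4 3)) (subst (7 * k ≤_) (*-assoc 4 2 i) 7k≤8i))

profile-of : ∀ {k i} → i ≤ k → k ≤ 2 * i →
  i ≡ (2 * i ∸ k) + (k ∸ i) × k ≡ (2 * i ∸ k) + 2 * (k ∸ i)
profile-of {k} {i} i≤k k≤2i = i≡b+j , k≡b+2j
  where
  open ≡-Reasoning
  b = 2 * i ∸ k
  j = k ∸ i
  self-sum : ∀ i → i + i ≡ 2 * i
  self-sum = solve-∀
  i≡b+j : i ≡ b + j
  i≡b+j = +-cancelʳ-≡ i i (b + j) (begin
      i + i        ≡⟨ self-sum i ⟩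
      2 * i        ≡⟨ m∸n+n≡m k≤2i ⟨
      b + k        ≡⟨ cong (b +_) (m∸n+n≡m i≤k) ⟨
      b + (j + i)  ≡⟨ +-assoc b j i ⟨
      b + j + i    ∎)
  k≡b+2j : k ≡ b + 2 * j
  k≡b+2j = begin
      k            ≡⟨ m∸n+n≡m i≤k ⟨
      j + i        ≡⟨ cong (j +_) i≡b+j ⟩
      j + (b + j)  ≡⟨ regroup j b ⟩
      b + 2 * j    ∎
    where
    regroup : ∀ j b → j + (b + j) ≡ b + 2 * j
    regroup = solve-∀

clear-denominators : ∀ X D N T E M K P .{{_ : NonZero D}} .{{_ : NonZero E}} →
  X * D ≡ N → T * E ≡ M → N ^ 16 * K * P * E ^ 16 ≤ 5 ^ 16 * M ^ 16 * D ^ 16 →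
  X ^ 16 * K * P ≤ 5 ^ 16 * T ^ 16
clear-denominators X D N T E M K P X*D≡N T*E≡M numerators =
  *-cancelʳ-≤ _ _ (D ^ 16 * E ^ 16) {{m*n≢0 _ _ {{m^n≢0 D 16}} {{m^n≢0 E 16}}}} (begin
    X ^ 16 * K * P * (D ^ 16 * E ^ 16)
  ≡⟨ regroup (X ^ 16) K P (D ^ 16) (E ^ 16) ⟩
    X ^ 16 * D ^ 16 * K * P * E ^ 16
  ≡⟨ cong (λ z → z * K * P * E ^ 16) (trans (sym (^-distribʳ-* X D 16)) (cong (_^ 16) X*D≡N)) ⟩
    N ^ 16 * K * P * E ^ 16
  ≤⟨ numerators ⟩
    5 ^ 16 * M ^ 16 * D ^ 16
  ≡⟨ cong (λ z → 5 ^ 16 * z * D ^ 16) (trans (cong (_^ 16) (sym T*E≡M)) (^-distribʳ-* T E 16)) ⟩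
    5 ^ 16 * (T ^ 16 * E ^ 16) * D ^ 16
  ≡⟨ regroup′ (5 ^ 16) (T ^ 16) (E ^ 16) (D ^ 16) ⟩
    5 ^ 16 * T ^ 16 * (D ^ 16 * E ^ 16) ∎)
  where
  open ≤-Reasoning
  regroup : ∀ x k p d e → x * k * p * (d * e) ≡ x * d * k * p * e
  regroup = solve-∀
  regroup′ : ∀ c t e d → c * (t * e) * d ≡ c * t * (d * e)
  regroup′ = solve-∀

-- The theorem for fixed k and i in exact integer arithmetic, using the closed
-- forms |E_i| = k! 2^b / (j! b! j!) and C(2k,k) = (2k)! / (k! k!),
-- where b = 2i - k and j = k - i.
ExactBound : ℕ → ℕ → Set
ExactBound k i =
  (k ! * 2 ^ b) ^ 16 * k ^ 8 * 2 ^ k * (k ! * k !) ^ 16 ≤ 5 ^ 16 * ((k + k) !) ^ 16 * (j ! * (b ! * j !)) ^ 16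
  where
  b = 2 * i ∸ k
  j = k ∸ i

exactBound? : ∀ k i → Dec (ExactBound k i)
exactBound? k i = _ ≤? _

small-exact : ∀ {k} → k < 29 → ∀ {i} → i < suc k → 7 * k ≤ 8 * i → ExactBound k i
small-exact = toWitness {a? = allUpTo? (λ k → allUpTo? (λ i → (7 * k ≤? 8 * i) →-dec exactBound? k i) (suc k)) 29} tt

small-case : ∀ k i → k < 29 → i ≤ k → 7 * k ≤ 8 * i →
  countE k i ^ 16 * k ^ 8 * 2 ^ k ≤ 5 ^ 16 * total k ^ 16
small-case k i k<29 i≤k 7k≤8i =
  clear-denominators (countE k i) (j ! * (b ! * j !)) (k ! * 2 ^ b) (total k) (k ! * k !) ((k + k) !) (k ^ 8) (2 ^ k)
    {{m*n≢0 _ _ {{j !≢0}} {{b !* j !≢0}}}} {{k !* k !≢0}}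
    countE-closed (total-closed k) (small-exact k<29 (s≤s i≤k) 7k≤8i)
  where
  b = 2 * i ∸ k
  j = k ∸ i
  absent : ∀ b j → j + b + j ≡ b + 2 * j
  absent = solve-∀
  countE-closed : countE k i * (j ! * (b ! * j !)) ≡ k ! * 2 ^ b
  countE-closed with profile-of i≤k (half-of {k} {i} 7k≤8i)
  ... | i≡b+j , k≡b+2j = trans (cong (_* (j ! * (b ! * j !))) (countE-profile k i b j i≡b+j k≡b+2j))
                            (ofProfile-formula k j b j (trans (absent b j) (sym k≡b+2j)))

-- Lemma 4: for i ≥ 7k/8, Pr[E_i] ≤ (5/√k) 2^(-k/16), in the cleared form
-- |E_i|^16 k^8 2^k ≤ 5^16 C(2k,k)^16; the case i > k is trivial since E_i is empty.
lemma4 : (k i : ℕ) → 1 ≤ k → 7 * k ≤ 8 * i →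
    countE k i ^ 16 * k ^ 8 * 2 ^ k ≤ 5 ^ 16 * total k ^ 16
lemma4 k i _ 7k≤8i = by-cases (k <? 29) (i ≤? k)
  where
  by-cases : Dec (k < 29) → Dec (i ≤ k) → countE k i ^ 16 * k ^ 8 * 2 ^ k ≤ 5 ^ 16 * total k ^ 16
  by-cases (no k≮29) _ = large-case k i (≮⇒≥ k≮29) 7k≤8i
  by-cases (yes k<29) (yes i≤k) = small-case k i k<29 i≤k 7k≤8i
  by-cases (yes _) (no i≰k) = subst (λ n → n ^ 16 * k ^ 8 * 2 ^ k ≤ 5 ^ 16 * total k ^ 16) (sym (countE-beyond k i (≰⇒> i≰k))) z≤n
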